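{- Let $G$ be a cactus graph with fire source $r$, and let $\Psi^*$ be the set of vertices protected by an optimal solution of a firefighting instance on $G$. Suppose $\{P_1, \dots, P_m\}$ is a partition of $\Psi^*$ that is cycle-respecting, i.e. for every simple cycle $C$ of $G$, all vertices of $V(C) \cap \Psi^*$ belong to the same part $P_j$. Then $\kappa(\Psi^*) = \bigcup_{i=1}^m \kappa(P_i)$.
   Context: Firefighting game: $G$ a finite undirected graph, $r$ the fire source, $f_i\ge0$ integers; initially only $r$ burns; in round $i$ at most $f_i$ non-burning unprotected vertices are protected (protected vertices never burn), then fire spreads from each burning vertex to all unprotected neighbours. An optimal solution saves the maximum number of vertices. A cactus graph is a graph in which every edge lies on at most one simple cycle. For $S \subseteq V(G)\setminus\{r\}$, the covered set $\kappa(S)$ is the set of vertices $u$ of $G$ such that every path from $u$ to $r$ contains at least one vertex of $S$. -}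

module Defs where

open import Data.Nat using (ℕ; zero; suc; _≤_)
open import Data.Fin using (Fin)
open import Data.Fin.Subset using (Subset; ⁅_⁆; _∪_; _∩_; ∁; ∣_∣; _∈_; _∉_)
  renaming (⊥ to ∅)
open import Data.Bool using (Bool; true; false; _∧_; _∨_)
open import Data.Vec using (tabulate)
open import Data.List using (List; []; _∷_; _++_; take; length; head; last)
open import Data.List.Relation.Unary.Any using (Any)
open import Data.List.Relation.Unary.Unique.Propositional using (Unique)
import Data.List.Membership.Propositional as LM
open import Data.Maybe using (Maybe; just)
open import Data.Product using (Σ; ∃; _×_; _,_; proj₁; proj₂)
open import Data.Sum using (_⊎_)
open import Data.Unit using (⊤)
open import Relation.Binary.PropositionalEquality using (_≡_)
open import Function using (_⇔_)

record Graph (n : ℕ) : Set where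
  field
    adj    : Fin n → Fin n → Bool
    sym    : ∀ u v → adj u v ≡ adj v u
    irrefl : ∀ u → adj u u ≡ false
open Graph public

Adj : ∀ {n} → Graph n → Fin n → Fin n → Set
Adj G u v = adj G u v ≡ true

Chain : ∀ {n} → Graph n → List (Fin n) → Set
Chain G []           = ⊤
Chain G (x ∷ [])     = ⊤
Chain G (x ∷ y ∷ xs) = Adj G x y × Chain G (y ∷ xs)

IsPath : ∀ {n} → Graph n → Fin n → Fin n → List (Fin n) → Set
IsPath G u v p = head p ≡ just u × last p ≡ just v × Chain G p × Unique p

Connected : ∀ {n} → Graph n → Set
Connected G = ∀ u v → ∃ λ p → IsPath G u v p

-- c = v₀ … v_{k-1} is a simple cycle (k ≥ 3, distinct, v_{k-1} v₀ an edge)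
IsCycle : ∀ {n} → Graph n → List (Fin n) → Set
IsCycle G c = 3 ≤ length c × Unique c × Chain G (c ++ take 1 c)

data Consec {n : ℕ} : List (Fin n) → Fin n → Fin n → Set where
  here  : ∀ {u v xs} → Consec (u ∷ v ∷ xs) u v
  there : ∀ {x u v xs} → Consec xs u v → Consec (x ∷ xs) u v

CycleEdge : ∀ {n} → List (Fin n) → Fin n → Fin n → Set
CycleEdge c u v = Consec (c ++ take 1 c) u v ⊎ Consec (c ++ take 1 c) v u

-- cactus: every edge lies on at most one simple cycle, i.e. two simple
-- cycles sharing an edge have the same edge set (are the same cycle)
Cactus : ∀ {n} → Graph n → Set
Cactus G = ∀ c c' → IsCycle G c → IsCycle G c' →
  ∀ u v → CycleEdge c u v → CycleEdge c' u v →
  ∀ x y → CycleEdge c x y → CycleEdge c' x y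

κ : ∀ {n} → Graph n → Fin n → Subset n → Fin n → Set
κ G r S u = ∀ p → IsPath G u r p → Any (_∈ S) p

anyFin : ∀ {n} → (Fin n → Bool) → Bool
anyFin {zero}  f = false
anyFin {suc n} f = f Fin.zero ∨ anyFin (λ i → f (Fin.suc i))
  where import Data.Fin as Fin

nbr : ∀ {n} → Graph n → Subset n → Subset n
nbr G B = tabulate (λ v → anyFin (λ w → adj G v w ∧ Data.Vec.lookup B w))
  where import Data.Vec

spread : ∀ {n} → Graph n → Subset n → Subset n → Subset n
spread G P B = B ∪ (∁ P ∩ nbr G B)

iter : ∀ {A : Set} → ℕ → (A → A) → A → A
iter zero    g a = a
iter (suc k) g a = g (iter k g a)

-- A strategy: the list of vertex sets protected in rounds 1, 2, …, T;
-- in all later rounds nothing is protected.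
Strategy : ℕ → Set
Strategy n = List (Subset n)

run : ∀ {n} → Graph n → Subset n → Subset n → Strategy n → Subset n × Subset n
run G B P []       = B , P
run G B P (S ∷ ss) = run G (spread G (P ∪ S) B) (P ∪ S) ss

Valid : ∀ {n} → Graph n → (ℕ → ℕ) → ℕ → Subset n → Subset n → Strategy n → Set
Valid G f i B P []       = ⊤
Valid G f i B P (S ∷ ss) =
  ∣ S ∣ ≤ f i × (∀ v → v ∈ S → v ∉ B × v ∉ P) ×
  Valid G f (suc i) (spread G (P ∪ S) B) (P ∪ S) ss

ValidStrategy : ∀ {n} → Graph n → Fin n → (ℕ → ℕ) → Strategy n → Set
ValidStrategy G r f ss = Valid G f 1 ⁅ r ⁆ ∅ ss

-- final burning set: after the strategy, the fire spreads n more rounds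
-- (enough for it to stop spreading)
finalBurning : ∀ {n} → Graph n → Fin n → Strategy n → Subset n
finalBurning {n} G r ss =
  iter n (spread G (proj₂ (run G ⁅ r ⁆ ∅ ss))) (proj₁ (run G ⁅ r ⁆ ∅ ss))

protectedSet : ∀ {n} → Graph n → Fin n → Strategy n → Subset n
protectedSet G r ss = proj₂ (run G ⁅ r ⁆ ∅ ss)

saved : ∀ {n} → Graph n → Fin n → Strategy n → ℕ
saved G r ss = ∣ ∁ (finalBurning G r ss) ∣

Optimal : ∀ {n} → Graph n → Fin n → (ℕ → ℕ) → Strategy n → Set
Optimal G r f ss = ValidStrategy G r f ss ×
  (∀ ss' → ValidStrategy G r f ss' → saved G r ss' ≤ saved G r ss)

IsPartition : ∀ {n m} → Subset n → (Fin m → Subset n) → Set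
IsPartition {n} {m} Ψ P =
  (∀ v → (v ∈ Ψ) ⇔ (∃ λ i → v ∈ P i)) ×
  (∀ i j v → v ∈ P i → v ∈ P j → i ≡ j) ×
  (∀ i → ∃ λ v → v ∈ P i)

CycleRespecting : ∀ {n m} → Graph n → Subset n → (Fin m → Subset n) → Set
CycleRespecting G Ψ P = ∀ c → IsCycle G c →
  ∀ x y → x LM.∈ c → y LM.∈ c → x ∈ Ψ → y ∈ Ψ →
  ∀ i j → x ∈ P i → y ∈ P j → i ≡ j

-- As Pᵢ ⊆ Ψ, κ(Pᵢ) ⊆ κ(Ψ).  Conversely, suppose that for every j some
-- u–r path qⱼ avoids Pⱼ, and let p be any u–r path.  If p meets Ψ at b ∈ Pⱼ, then qⱼ leaves the part
-- of p before b at a last vertex x and next meets the part after b at y; its stretch t from x to y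
-- and the segment of p from x through b to y form a simple cycle through b.  Every protected vertex
-- of that cycle lies in Pⱼ, which qⱼ avoids, so x t y carries no protected vertex, and replacing the
-- segment by it gives a u–r path with fewer protected vertices.  Iterating yields a u–r path avoiding
-- Ψ, so u ∉ κ(Ψ).  The choice of j is constructive because κ is decidable: simple paths have at
-- most n vertices.

module Submission where

open import Defs hiding (sym)

open import Data.Bool using (true)
import Data.Bool.Properties as Bool
open import Data.Empty using (⊥-elim)
open import Data.Fin using (Fin)
open import Data.Fin.Properties using (_≟_)
import Data.Fin.Properties as FinP
open import Data.Fin.Subset as Sub using (Subset; ⁅_⁆; _∪_; _∩_; ∣_∣)
  renaming (⊥ to ∅; _∈_ to _∈ₛ_; _∉_ to _∉ₛ_)
open import Data.Fin.Subset.Properties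
  using (∉⊥; x∈⁅x⁆; x∈⁅y⁆⇒x≡y; x∈p∪q⁺; x∈p∪q⁻; x∈p∩q⁺; x∈p∩q⁻; q⊆p∪q; p⊂q⇒∣p∣<∣q∣; ∣p∣≤n)
  renaming (_∈?_ to _∈ₛ?_)
open import Data.List
  using (List; []; _∷_; _++_; [_]; reverse; length; head; last; allFin; cartesianProductWith)
open import Data.List.Properties using (++-assoc; reverse-++; unfold-reverse)
open import Data.List.Relation.Unary.Any using (Any; here; there; any?; satisfied)
open import Data.List.Relation.Unary.All using (All; []; _∷_; all?)
import Data.List.Relation.Unary.All as All
import Data.List.Relation.Unary.All.Properties as Allₚ
import Data.List.Relation.Unary.Any as Any
import Data.List.Relation.Unary.Any.Properties as Anyₚ
open import Data.List.Relation.Unary.AllPairs using ([]; _∷_)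
open import Data.List.Relation.Unary.Unique.Propositional using (Unique)
import Data.List.Relation.Unary.Unique.Propositional.Properties as Unique
import Data.List.Relation.Unary.Unique.DecPropositional as UniqueDec
open import Data.List.Relation.Binary.Disjoint.Propositional using (Disjoint)
open import Data.List.Relation.Binary.Subset.Propositional using (_⊆_)
open import Data.List.Relation.Binary.Permutation.Propositional using (↭-sym; ↭⇒↭ₛ)
open import Data.List.Relation.Binary.Permutation.Propositional.Properties using (↭-reverse)
import Data.List.Relation.Binary.Permutation.Setoid.Properties as PermutationₛProperties
import Data.List.Membership.DecPropositional as DecMembership
open import Data.List.Membership.Propositional using (_∈_; _∉_; lose; find)
open import Data.List.Membership.Propositional.Properties
  using (∈-++⁺ˡ; ∈-++⁺ʳ; ∈-++⁻; ∈-∃++; ∈-allFin; ∈-cartesianProductWith⁺)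
open import Data.Maybe using (just)
open import Data.Maybe.Properties using (just-injective; ≡-dec)
open import Data.Nat using (ℕ; zero; suc; _≤_; _<_; z≤n; s≤s)
open import Data.Nat.Induction using (<-wellFounded)
open import Data.Nat.Properties using (≤-trans; ≤-<-trans)
open import Data.Product using (∃; ∃-syntax; _×_; _,_; proj₁; proj₂; map₁)
open import Data.Sum using (_⊎_; inj₁; inj₂)
open import Data.Unit using (tt)
open import Function using (_⇔_; mk⇔; Equivalence)
open import Induction.WellFounded using (Acc; acc)
import Relation.Binary.Construct.On as On
open import Relation.Binary.PropositionalEquality
  using (_≡_; _≢_; refl; sym; trans; cong; subst; setoid; module ≡-Reasoning)
open import Relation.Nullary using (¬_; Dec; yes; no; ¬?; _×-dec_)
open import Relation.Unary using (Decidable; ∁)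

module _ {A : Set} where

  head-++ : ∀ (xs : List A) {y ys zs} → head (xs ++ y ∷ ys) ≡ head (xs ++ y ∷ zs)
  head-++ []       = refl
  head-++ (x ∷ xs) = refl

  last-++ : ∀ (xs : List A) {y ys} → last (xs ++ y ∷ ys) ≡ last (y ∷ ys)
  last-++ []            = refl
  last-++ (x ∷ [])      = refl
  last-++ (x ∷ x′ ∷ xs) = last-++ (x′ ∷ xs)

  head⇒∈ : ∀ {xs : List A} {v} → head xs ≡ just v → v ∈ xs
  head⇒∈ {x ∷ xs} refl = here refl

  last⇒∈ : ∀ (xs : List A) {v} → last xs ≡ just v → v ∈ xs
  last⇒∈ (x ∷ [])      refl = here refl
  last⇒∈ (x ∷ x′ ∷ xs) e    = there (last⇒∈ (x′ ∷ xs) e)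

  head∈prefix : ∀ (xs : List A) {b ys u} → head (xs ++ b ∷ ys) ≡ just u → u ≢ b → u ∈ xs
  head∈prefix []       e u≢b = ⊥-elim (u≢b (sym (just-injective e)))
  head∈prefix (x ∷ xs) e _   = here (sym (just-injective e))

  last∈suffix : ∀ (xs : List A) {b} ys {v} → last (xs ++ b ∷ ys) ≡ just v → v ≢ b → v ∈ ys
  last∈suffix xs []       e v≢b = ⊥-elim (v≢b (sym (just-injective (trans (sym (last-++ xs)) e))))
  last∈suffix xs (y ∷ ys) e _   = last⇒∈ (y ∷ ys) (trans (sym (last-++ xs)) e)

  ∈-segment : ∀ (a : List A) {x} s {y} c {v} → v ∈ x ∷ s ++ [ y ] → v ∈ a ++ x ∷ s ++ y ∷ c
  ∈-segment a {x} s {y} c {v} v∈ = ∈-++⁺ʳ a (subst (v ∈_) (++-assoc (x ∷ s) [ y ] c) (∈-++⁺ˡ v∈))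

  ∈-spliced⁻ : ∀ (a : List A) {x} t {y} c {v} → v ∈ a ++ x ∷ t ++ y ∷ c → v ∈ a ⊎ v ∈ x ∷ t ++ [ y ] ⊎ v ∈ c
  ∈-spliced⁻ a {x} t c v∈ with ∈-++⁻ a v∈
  ... | inj₁ v∈a = inj₁ v∈a
  ... | inj₂ v∈′ with ∈-++⁻ (x ∷ t) v∈′
  ...   | inj₁ v∈xt          = inj₂ (inj₁ (∈-++⁺ˡ v∈xt))
  ...   | inj₂ (here refl)   = inj₂ (inj₁ (∈-++⁺ʳ (x ∷ t) (here refl)))
  ...   | inj₂ (there v∈c)   = inj₂ (inj₂ v∈c)

  ∈-closingPath⇒∈-cycle : ∀ {x y} s (t : List A) {v} → v ∈ x ∷ t ++ [ y ] → v ∈ x ∷ s ++ y ∷ reverse t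
  ∈-closingPath⇒∈-cycle s t (here refl) = here refl
  ∈-closingPath⇒∈-cycle s t (there v∈) with ∈-++⁻ t v∈
  ... | inj₁ v∈t        = there (∈-++⁺ʳ s (there (Anyₚ.reverse⁺ v∈t)))
  ... | inj₂ (here refl) = there (∈-++⁺ʳ s (here refl))

  ∈∧∉⇒≢ : ∀ {xs : List A} {v w} → v ∈ xs → w ∉ xs → v ≢ w
  ∈∧∉⇒≢ v∈ w∉ refl = w∉ v∈

  Unique-++⁻ : ∀ xs {ys : List A} → Unique (xs ++ ys) → Unique xs × Unique ys × Disjoint xs ys
  Unique-++⁻ []       u          = [] , u , λ ()
  Unique-++⁻ (x ∷ xs) (x∉ ∷ u) with Unique-++⁻ xs u
  ... | uxs , uys , disjoint = Allₚ.++⁻ˡ xs x∉ ∷ uxs , uys , λ where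
    (here refl  , v∈ys) → All.lookup (Allₚ.++⁻ʳ xs x∉) v∈ys refl
    (there v∈xs , v∈ys) → disjoint (v∈xs , v∈ys)

  Unique-segment : ∀ (a : List A) {x} s {y} c → Unique (a ++ x ∷ s ++ y ∷ c) → Unique (x ∷ s ++ [ y ])
  Unique-segment a {x} s {y} c u =
    proj₁ (Unique-++⁻ (x ∷ s ++ [ y ])
      (subst Unique (sym (++-assoc (x ∷ s) [ y ] c)) (proj₁ (proj₂ (Unique-++⁻ a u)))))

  Unique-interior : ∀ {x y} {t : List A} → Unique (x ∷ t ++ [ y ]) → Unique t
  Unique-interior {t = t} (_ ∷ u) = proj₁ (Unique-++⁻ t u)

  Unique-reverse : ∀ {xs : List A} → Unique xs → Unique (reverse xs)
  Unique-reverse {xs} = PermutationₛProperties.Unique-resp-↭ (setoid A) (↭⇒↭ₛ (↭-sym (↭-reverse xs)))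

  module _ {P : A → Set} (P? : Decidable P) where

    splitAtFirst : ∀ {xs} → Any P xs → ∃[ ys ] ∃[ z ] ∃[ zs ] xs ≡ ys ++ z ∷ zs × All (∁ P) ys × P z
    splitAtFirst {x ∷ xs} any with P? x | any
    ... | yes px | _         = [] , x , xs , refl , [] , px
    ... | no ¬px | here px   = ⊥-elim (¬px px)
    ... | no ¬px | there any with splitAtFirst any
    ...   | ys , z , zs , refl , ¬Pys , pz = x ∷ ys , z , zs , refl , ¬px ∷ ¬Pys , pz

    splitAtLast : ∀ {xs} → Any P xs → ∃[ ys ] ∃[ z ] ∃[ zs ] xs ≡ ys ++ z ∷ zs × P z × All (∁ P) zs
    splitAtLast {x ∷ xs} any with any? P? xs | any
    ... | yes anyXs | _ with splitAtLast anyXs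
    ...   | ys , z , zs , refl , pz , ¬Pzs = x ∷ ys , z , zs , refl , pz , ¬Pzs
    splitAtLast {x ∷ xs} any | no ¬anyXs | here px   = [] , x , xs , refl , px , Allₚ.¬Any⇒All¬ xs ¬anyXs
    splitAtLast {x ∷ xs} any | no ¬anyXs | there any′ = ⊥-elim (¬anyXs any′)

  data Crossing (P Q : A → Set) : List A → Set where
    crossing : ∀ xs {x} t {y} ys → P x → Q y → All (∁ P) t → All (∁ Q) t →
               Crossing P Q (xs ++ x ∷ t ++ y ∷ ys)

  findCrossing : ∀ {P Q : A → Set} → Decidable P → Decidable Q → (∀ {v} → P v → ¬ Q v) →
              ∀ {xs z} → head xs ≡ just z → P z → Any Q xs → Crossing P Q xs
  findCrossing {P} {Q} P? Q? P⇒¬Q {z = z} head≡z pz anyQ with splitAtFirst Q? anyQ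
  ... | ys , y , zs , refl , ¬Qys , qy with splitAtLast P? (P-in-prefix ys head≡z)
    where
    P-in-prefix : ∀ ys {zs} → head (ys ++ y ∷ zs) ≡ just z → Any P ys
    P-in-prefix []       e = ⊥-elim (P⇒¬Q (subst P (sym (just-injective e)) pz) qy)
    P-in-prefix (w ∷ ws) e = here (subst P (sym (just-injective e)) pz)
  ...   | xs , x , t , refl , px , ¬Pt =
    subst (Crossing P Q) (sym (++-assoc xs (x ∷ t) (y ∷ zs)))
      (crossing xs t zs px qy ¬Pt (All.tail (Allₚ.++⁻ʳ xs ¬Qys)))

module _ {A : Set} (elements : List A) (complete : ∀ x → x ∈ elements) where

  listsUpTo : ℕ → List (List A)
  listsUpTo zero    = [ [] ]
  listsUpTo (suc k) = [] ∷ cartesianProductWith _∷_ elements (listsUpTo k)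

  ∈-listsUpTo : ∀ k {xs : List A} → length xs ≤ k → xs ∈ listsUpTo k
  ∈-listsUpTo zero    {[]}     _       = here refl
  ∈-listsUpTo (suc k) {[]}     _       = here refl
  ∈-listsUpTo (suc k) {x ∷ xs} (s≤s l) =
    there (∈-cartesianProductWith⁺ _∷_ (complete x) (∈-listsUpTo k l))

vertexSet : ∀ {n} → List (Fin n) → Subset n
vertexSet []       = ∅
vertexSet (x ∷ xs) = ⁅ x ⁆ ∪ vertexSet xs

module _ {n} {v : Fin n} where

  ∈-vertexSet⁺ : ∀ {xs} → v ∈ xs → v ∈ₛ vertexSet xs
  ∈-vertexSet⁺ (here refl) = x∈p∪q⁺ (inj₁ (x∈⁅x⁆ v))
  ∈-vertexSet⁺ (there v∈)  = x∈p∪q⁺ (inj₂ (∈-vertexSet⁺ v∈))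

  ∈-vertexSet⁻ : ∀ xs → v ∈ₛ vertexSet xs → v ∈ xs
  ∈-vertexSet⁻ []       v∈ = ⊥-elim (∉⊥ v∈)
  ∈-vertexSet⁻ (x ∷ xs) v∈ with x∈p∪q⁻ ⁅ x ⁆ (vertexSet xs) v∈
  ... | inj₁ v∈⁅x⁆ = here (x∈⁅y⁆⇒x≡y x v∈⁅x⁆)
  ... | inj₂ v∈xs  = there (∈-vertexSet⁻ xs v∈xs)

Unique⇒length≤∣vertexSet∣ : ∀ {n} {xs : List (Fin n)} → Unique xs → length xs ≤ ∣ vertexSet xs ∣
Unique⇒length≤∣vertexSet∣ {xs = []}     []         = z≤n
Unique⇒length≤∣vertexSet∣ {xs = x ∷ xs} (x∉ ∷ u) =
  ≤-<-trans (Unique⇒length≤∣vertexSet∣ u)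
    (p⊂q⇒∣p∣<∣q∣ (q⊆p∪q ⁅ x ⁆ (vertexSet xs) , x , ∈-vertexSet⁺ {xs = x ∷ xs} (here refl) , x∉xs))
  where
  x∉xs : x ∉ₛ vertexSet xs
  x∉xs x∈ = All.lookup x∉ (∈-vertexSet⁻ xs x∈) refl

Unique⇒length≤n : ∀ {n} {xs : List (Fin n)} → Unique xs → length xs ≤ n
Unique⇒length≤n {xs = xs} u = ≤-trans (Unique⇒length≤∣vertexSet∣ u) (∣p∣≤n (vertexSet xs))

∣∩vertexSet∣-< : ∀ {n} (S : Subset n) {xs ys b} → (∀ {v} → v ∈ ys → v ∈ₛ S → v ∈ xs × v ≢ b) →
                 b ∈ xs → b ∈ₛ S → ∣ S ∩ vertexSet ys ∣ < ∣ S ∩ vertexSet xs ∣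
∣∩vertexSet∣-< S {xs} {ys} {b} ys∩S⊆xs-b b∈xs b∈S =
  p⊂q⇒∣p∣<∣q∣ (⊆ , b , x∈p∩q⁺ (b∈S , ∈-vertexSet⁺ b∈xs) , b∉)
  where
  ⊆ : ∀ {v} → v ∈ₛ S ∩ vertexSet ys → v ∈ₛ S ∩ vertexSet xs
  ⊆ v∈ with x∈p∩q⁻ S (vertexSet ys) v∈
  ... | v∈S , v∈ys = x∈p∩q⁺ (v∈S , ∈-vertexSet⁺ (proj₁ (ys∩S⊆xs-b (∈-vertexSet⁻ ys v∈ys) v∈S)))
  b∉ : b ∉ₛ S ∩ vertexSet ys
  b∉ b∈ = proj₂ (ys∩S⊆xs-b (∈-vertexSet⁻ ys (proj₂ (x∈p∩q⁻ S (vertexSet ys) b∈))) b∈S) refl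

module Walks {n} (G : Graph n) where

  Chain-split : ∀ xs {y ys} → Chain G (xs ++ y ∷ ys) → Chain G (xs ++ [ y ]) × Chain G (y ∷ ys)
  Chain-split []            c       = tt , c
  Chain-split (x ∷ [])      (a , c) = (a , tt) , c
  Chain-split (x ∷ x′ ∷ xs) (a , c) with Chain-split (x′ ∷ xs) c
  ... | c₁ , c₂ = (a , c₁) , c₂

  Chain-join : ∀ xs {y ys} → Chain G (xs ++ [ y ]) → Chain G (y ∷ ys) → Chain G (xs ++ y ∷ ys)
  Chain-join []            _        c₂ = c₂
  Chain-join (x ∷ [])      (a , _)  c₂ = a , c₂
  Chain-join (x ∷ x′ ∷ xs) (a , c₁) c₂ = a , Chain-join (x′ ∷ xs) c₁ c₂

  Chain-reverse : ∀ xs → Chain G xs → Chain G (reverse xs)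
  Chain-reverse []           _       = tt
  Chain-reverse (x ∷ [])     _       = tt
  Chain-reverse (x ∷ y ∷ zs) (a , c) = subst (Chain G) (sym reverse-shape)
    (Chain-join (reverse zs) (subst (Chain G) (unfold-reverse y zs) (Chain-reverse (y ∷ zs) c))
      (trans (Graph.sym G y x) a , tt))
    where
    open ≡-Reasoning
    reverse-shape : reverse (x ∷ y ∷ zs) ≡ reverse zs ++ y ∷ [ x ]
    reverse-shape = begin
      reverse (x ∷ y ∷ zs)         ≡⟨ unfold-reverse x (y ∷ zs) ⟩
      reverse (y ∷ zs) ++ [ x ]    ≡⟨ cong (_++ [ x ]) (unfold-reverse y zs) ⟩
      (reverse zs ++ [ y ]) ++ [ x ] ≡⟨ ++-assoc (reverse zs) [ y ] [ x ] ⟩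
      reverse zs ++ y ∷ [ x ]      ∎

  Chain-segment : ∀ a {x} s {y} c → Chain G (a ++ x ∷ s ++ y ∷ c) → Chain G (x ∷ s ++ [ y ])
  Chain-segment a {x} s c ch = proj₁ (Chain-split (x ∷ s) (proj₂ (Chain-split a ch)))

  Chain-splice : ∀ a {x} s {y} c {t} → Chain G (a ++ x ∷ s ++ y ∷ c) → Chain G (x ∷ t ++ [ y ]) →
                 Chain G (a ++ x ∷ t ++ y ∷ c)
  Chain-splice a {x} s c {t} ch ch-t with Chain-split a ch
  ... | ch-a , ch-rest = Chain-join a ch-a (Chain-join (x ∷ t) ch-t (proj₂ (Chain-split (x ∷ s) ch-rest)))

  walk⇒path : ∀ xs {u v} → head xs ≡ just u → last xs ≡ just v → Chain G xs →
              ∃ λ ys → IsPath G u v ys × ys ⊆ xs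
  walk⇒path (x ∷ []) hu hv _ = x ∷ [] , (hu , hv , tt , [] ∷ []) , λ v∈ → v∈
  walk⇒path (x ∷ y ∷ zs) hu hv (a , c) with walk⇒path (y ∷ zs) refl hv c
  ... | ys , (hy , ly , cy , uy) , ys⊆ with any? (x ≟_) ys
  ...   | yes x∈ys with a′ , b′ , refl ← ∈-∃++ x∈ys =
    x ∷ b′ ,
    (hu , trans (sym (last-++ a′)) ly , proj₂ (Chain-split a′ cy) , proj₁ (proj₂ (Unique-++⁻ a′ uy))) ,
      λ v∈ → there (ys⊆ (∈-++⁺ʳ a′ v∈))
  walk⇒path (x ∷ y ∷ zs) hu hv (a , c) | y′ ∷ t , (refl , ly , cy , uy) , ys⊆ | no x∉ys =
    x ∷ y′ ∷ t , (hu , ly , (a , cy) , Allₚ.¬Any⇒All¬ (y′ ∷ t) x∉ys ∷ uy) , λ where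
      (here e)   → here e
      (there v∈) → there (ys⊆ v∈)

  internallyDisjointPaths⇒cycle :
    ∀ {x y z} s {t} → z ∈ s → Chain G (x ∷ s ++ [ y ]) → Unique (x ∷ s ++ [ y ]) →
    Chain G (x ∷ t ++ [ y ]) → Unique (x ∷ t ++ [ y ]) → Disjoint (x ∷ s ++ [ y ]) t →
    IsCycle G (x ∷ s ++ y ∷ reverse t)
  internallyDisjointPaths⇒cycle {x} {y} s {t} z∈s ch-s u-s ch-t u-t disjoint =
    length≥3 z∈s , unique , closed
    where
    length≥3 : ∀ {z s} → z ∈ s → 3 ≤ length (x ∷ s ++ y ∷ reverse t)
    length≥3 {s = _ ∷ []}    _ = s≤s (s≤s (s≤s z≤n))
    length≥3 {s = _ ∷ _ ∷ _} _ = s≤s (s≤s (s≤s z≤n))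
    unique : Unique (x ∷ s ++ y ∷ reverse t)
    unique = subst Unique (++-assoc (x ∷ s) [ y ] (reverse t))
      (Unique.++⁺ u-s (Unique-reverse (Unique-interior u-t))
        λ (v∈s , v∈t) → disjoint (v∈s , Anyₚ.reverse⁻ v∈t))
    back : reverse (x ∷ t ++ [ y ]) ≡ y ∷ reverse t ++ [ x ]
    back = trans (reverse-++ (x ∷ t) [ y ]) (cong (y ∷_) (unfold-reverse x t))
    closed : Chain G ((x ∷ s ++ y ∷ reverse t) ++ [ x ])
    closed = subst (Chain G) (cong (x ∷_) (sym (++-assoc s (y ∷ reverse t) [ x ])))
      (Chain-join (x ∷ s) ch-s (subst (Chain G) back (Chain-reverse (x ∷ t ++ [ y ]) ch-t)))

  Chain? : ∀ xs → Dec (Chain G xs)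
  Chain? []           = yes tt
  Chain? (x ∷ [])     = yes tt
  Chain? (x ∷ y ∷ xs) = (adj G x y Bool.≟ true) ×-dec Chain? (y ∷ xs)

  IsPath? : ∀ u v xs → Dec (IsPath G u v xs)
  IsPath? u v xs = ≡-dec _≟_ (head xs) (just u) ×-dec ≡-dec _≟_ (last xs) (just v)
                   ×-dec Chain? xs ×-dec UniqueDec.unique? _≟_ xs

  Avoids : Subset n → List (Fin n) → Set
  Avoids S = All (_∉ₛ S)

  avoidingPath⇒¬κ : ∀ {r u S p} → IsPath G u r p → Avoids S p → ¬ κ G r S u
  avoidingPath⇒¬κ {p = p} p-path p-avoids covered = Allₚ.All¬⇒¬Any p-avoids (covered p p-path)

  candidatePaths : List (List (Fin n))
  candidatePaths = listsUpTo (allFin n) ∈-allFin n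

  path∈candidatePaths : ∀ {u v p} → IsPath G u v p → p ∈ candidatePaths
  path∈candidatePaths (_ , _ , _ , unique) = ∈-listsUpTo (allFin n) ∈-allFin n (Unique⇒length≤n unique)

  κ-or-avoidingPath : ∀ r u S → κ G r S u ⊎ ∃ λ p → IsPath G u r p × Avoids S p
  κ-or-avoidingPath r u S with any? (λ p → IsPath? u r p ×-dec all? (λ v → ¬? (v ∈ₛ? S)) p) candidatePaths
  ... | yes ∃p = inj₂ (satisfied ∃p)
  ... | no ¬∃p = inj₁ covered
    where
    covered : κ G r S u
    covered p p-path with any? (_∈ₛ? S) p
    ... | yes hit = hit
    ... | no miss = ⊥-elim (¬∃p (lose (path∈candidatePaths p-path) (p-path , Allₚ.¬Any⇒All¬ p miss)))

  κ? : ∀ r u S → Dec (κ G r S u)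
  κ? r u S with κ-or-avoidingPath r u S
  ... | inj₁ covered            = yes covered
  ... | inj₂ (p , p-path , avs) = no (avoidingPath⇒¬κ p-path avs)

  ¬κ⇒avoidingPath : ∀ {r u S} → ¬ κ G r S u → ∃ λ p → IsPath G u r p × Avoids S p
  ¬κ⇒avoidingPath {r} {u} {S} ¬covered with κ-or-avoidingPath r u S
  ... | inj₁ covered = ⊥-elim (¬covered covered)
  ... | inj₂ path    = path

  Avoids⇒∉ : ∀ {S q b} → Avoids S q → b ∈ₛ S → b ∉ q
  Avoids⇒∉ q-avoids b∈S b∈q = All.lookup q-avoids b∈q b∈S

  κ-mono : ∀ {r u S T} → S Sub.⊆ T → κ G r S u → κ G r T u
  κ-mono S⊆T covered p p-path = Any.map S⊆T (covered p p-path)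

module Rerouting {n m} (G : Graph n) (r : Fin n) (Ψ : Subset n) (P : Fin m → Subset n)
                 (Ψ⊆⋃P : ∀ {v} → v ∈ₛ Ψ → ∃ λ k → v ∈ₛ P k) (respects : CycleRespecting G Ψ P) where

  open Walks G

  protected-on-cycle : ∀ {c} → IsCycle G c → ∀ {b j} → b ∈ c → b ∈ₛ Ψ → b ∈ₛ P j →
                       ∀ {v} → v ∈ c → v ∈ₛ Ψ → v ∈ₛ P j
  protected-on-cycle cyc b∈c bΨ bPj v∈c vΨ with k , vPk ← Ψ⊆⋃P vΨ =
    subst (λ i → _ ∈ₛ P i) (respects _ cyc _ _ v∈c b∈c vΨ bΨ k _ vPk bPj) vPk

  detour : ∀ {u} a {x} s {y} c {t b j} → IsPath G u r (a ++ x ∷ s ++ y ∷ c) →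
           b ∈ s → b ∈ₛ Ψ → b ∈ₛ P j →
           Chain G (x ∷ t ++ [ y ]) → Unique (x ∷ t ++ [ y ]) → Disjoint (x ∷ s ++ [ y ]) t →
           Avoids (P j) (x ∷ t ++ [ y ]) →
           ∃ λ p′ → IsPath G u r p′ × (∀ {v} → v ∈ p′ → v ∈ₛ Ψ → v ∈ a ++ x ∷ s ++ y ∷ c × v ≢ b)
  detour {u} a {x} s {y} c {t} {b} (hp , lp , cp , up) b∈s bΨ bPj ct ut disjoint t-avoids
    = let (p′ , p′-path , p′⊆) =
            walk⇒path (a ++ x ∷ t ++ y ∷ c) head-walk last-walk (Chain-splice a s c cp ct)
      in p′ , p′-path , λ v∈ → kept (∈-spliced⁻ a t c (p′⊆ v∈))
    where
    open ≡-Reasoning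
    head-walk : head (a ++ x ∷ t ++ y ∷ c) ≡ just u
    head-walk = trans (head-++ a) hp
    last-walk : last (a ++ x ∷ t ++ y ∷ c) ≡ just r
    last-walk = begin
      last (a ++ x ∷ t ++ y ∷ c) ≡⟨ last-++ a ⟩
      last (x ∷ t ++ y ∷ c)      ≡⟨ last-++ (x ∷ t) ⟩
      last (y ∷ c)               ≡⟨ last-++ (x ∷ s) ⟨
      last (x ∷ s ++ y ∷ c)      ≡⟨ last-++ a ⟨
      last (a ++ x ∷ s ++ y ∷ c) ≡⟨ lp ⟩
      just r                     ∎
    C = internallyDisjointPaths⇒cycle s b∈s (Chain-segment a s c cp) (Unique-segment a s c up)
          ct ut disjoint
    unprotected : ∀ {v} → v ∈ x ∷ t ++ [ y ] → v ∉ₛ Ψ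
    unprotected v∈ vΨ = All.lookup t-avoids v∈
      (protected-on-cycle C (there (∈-++⁺ˡ b∈s)) bΨ bPj (∈-closingPath⇒∈-cycle s t v∈) vΨ)
    kept : ∀ {v} → v ∈ a ⊎ v ∈ x ∷ t ++ [ y ] ⊎ v ∈ c → v ∈ₛ Ψ → v ∈ a ++ x ∷ s ++ y ∷ c × v ≢ b
    kept (inj₁ v∈a) _ = ∈-++⁺ˡ v∈a ,
      λ { refl → proj₂ (proj₂ (Unique-++⁻ a up)) (v∈a , there (∈-++⁺ˡ b∈s)) }
    kept (inj₂ (inj₁ v∈t)) vΨ = ⊥-elim (unprotected v∈t vΨ)
    kept (inj₂ (inj₂ v∈c)) _ = ∈-++⁺ʳ a (there (∈-++⁺ʳ s (there v∈c))) ,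
      λ { refl → proj₂ (proj₂ (Unique-++⁻ (x ∷ s) (proj₁ (proj₂ (Unique-++⁻ a up)))))
                   (there b∈s , there v∈c) }

  open DecMembership (_≟_ {n}) using (_∈?_)

  rerouteAt : ∀ {u} p₁ {b} p₂ {j q} → IsPath G u r (p₁ ++ b ∷ p₂) → b ∈ₛ Ψ → b ∈ₛ P j →
              IsPath G u r q → Avoids (P j) q →
              ∃ λ p′ → IsPath G u r p′ × (∀ {v} → v ∈ p′ → v ∈ₛ Ψ → v ∈ p₁ ++ b ∷ p₂ × v ≢ b)
  rerouteAt {u} p₁ {b} p₂ p-path@(hp , lp , _ , up) bΨ bPj (hq , lq , cq , uq) q-avoids
    with findCrossing (_∈? p₁) (_∈? p₂)
           (λ v∈p₁ v∈p₂ → proj₂ (proj₂ (Unique-++⁻ p₁ up)) (v∈p₁ , there v∈p₂)) hq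
           (head∈prefix p₁ hp (∈∧∉⇒≢ (head⇒∈ hq) (Avoids⇒∉ q-avoids bPj)))
           (lose (last⇒∈ _ lq) (last∈suffix p₁ p₂ lp (∈∧∉⇒≢ (last⇒∈ _ lq) (Avoids⇒∉ q-avoids bPj))))
  ... | crossing qa {x} t {y} qb x∈p₁ y∈p₂ t∉p₁ t∉p₂ with ∈-∃++ x∈p₁ | ∈-∃++ y∈p₂
  ... | a₁ , c₁ , refl | a₂ , c₂ , refl =
    let (p′ , p′-path , kept) =
          detour a₁ (c₁ ++ b ∷ a₂) c₂ (subst (IsPath G u r) shape p-path) (∈-++⁺ʳ c₁ (here refl)) bΨ bPj
            (Chain-segment qa t qb cq) (Unique-segment qa t qb uq) disjoint
            (All.tabulate (λ v∈ → All.lookup q-avoids (∈-segment qa t qb v∈)))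
    in p′ , p′-path , λ v∈ vΨ → map₁ (subst (_ ∈_) (sym shape)) (kept v∈ vΨ)
    where
    shape : (a₁ ++ x ∷ c₁) ++ b ∷ a₂ ++ y ∷ c₂ ≡ a₁ ++ x ∷ (c₁ ++ b ∷ a₂) ++ y ∷ c₂
    shape = trans (++-assoc a₁ (x ∷ c₁) (b ∷ a₂ ++ y ∷ c₂))
                  (cong (λ s → a₁ ++ x ∷ s) (sym (++-assoc c₁ (b ∷ a₂) (y ∷ c₂))))
    disjoint : Disjoint (x ∷ (c₁ ++ b ∷ a₂) ++ [ y ]) t
    disjoint {v} (v∈s , v∈t)
      with ∈-++⁻ (a₁ ++ x ∷ c₁) (subst (v ∈_) (sym shape) (∈-segment a₁ (c₁ ++ b ∷ a₂) c₂ v∈s))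
    ... | inj₁ v∈p₁         = All.lookup t∉p₁ v∈t v∈p₁
    ... | inj₂ (here refl)  = Avoids⇒∉ q-avoids bPj (∈-++⁺ʳ qa (there (∈-++⁺ˡ v∈t)))
    ... | inj₂ (there v∈p₂) = All.lookup t∉p₂ v∈t v∈p₂

  reroute : ∀ {u p} → IsPath G u r p → ∀ {b j} → b ∈ p → b ∈ₛ Ψ → b ∈ₛ P j →
            ∀ {q} → IsPath G u r q → Avoids (P j) q →
            ∃ λ p′ → IsPath G u r p′ × (∀ {v} → v ∈ p′ → v ∈ₛ Ψ → v ∈ p × v ≢ b)
  reroute p-path b∈p bΨ bPj q-path q-avoids with p₁ , p₂ , refl ← ∈-∃++ b∈p =
    rerouteAt p₁ p₂ p-path bΨ bPj q-path q-avoids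

  protectedCount : List (Fin n) → ℕ
  protectedCount p = ∣ Ψ ∩ vertexSet p ∣

  module _ {u} (avoiders : ∀ j → ∃ λ q → IsPath G u r q × Avoids (P j) q) where

    avoidingPath : ∀ p → IsPath G u r p → ∃ λ p′ → IsPath G u r p′ × Avoids Ψ p′
    avoidingPath p = go p (On.wellFounded protectedCount <-wellFounded p)
      where
      go : ∀ p → Acc (λ p′ p → protectedCount p′ < protectedCount p) p → IsPath G u r p →
           ∃ λ p′ → IsPath G u r p′ × Avoids Ψ p′
      go p (acc smaller) p-path with any? (_∈ₛ? Ψ) p
      ... | no unprotected = p , p-path , Allₚ.¬Any⇒All¬ p unprotected
      ... | yes hit with b , b∈p , bΨ ← find hit with j , bPj ← Ψ⊆⋃P bΨ
                    with q , q-path , q-avoids ← avoiders j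
                    with p′ , p′-path , kept ← reroute p-path b∈p bΨ bPj q-path q-avoids =
        go p′ (smaller (∣∩vertexSet∣-< Ψ kept b∈p bΨ)) p′-path

  κ⊆⋃κ : ∀ {u} → (∃ λ p → IsPath G u r p) → κ G r Ψ u → ∃ λ j → κ G r (P j) u
  κ⊆⋃κ {u} (p , p-path) covered with FinP.any? (λ j → κ? r u (P j))
  ... | yes coveredByClass = coveredByClass
  ... | no ¬coveredByClass =
    let (p′ , p′-path , avoids) =
          avoidingPath (λ j → ¬κ⇒avoidingPath (λ κj → ¬coveredByClass (j , κj))) p p-path
    in ⊥-elim (avoidingPath⇒¬κ p′-path avoids covered)

lemma2 : ∀ {n} (G : Graph n) (r : Fin n) (f : ℕ → ℕ) →
    Connected G → Cactus G →
    (ss : Strategy n) → Optimal G r f ss →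
    ∀ {m} (P : Fin m → Subset n) →
    IsPartition (protectedSet G r ss) P →
    CycleRespecting G (protectedSet G r ss) P →
    ∀ u → κ G r (protectedSet G r ss) u ⇔ (∃ λ i → κ G r (P i) u)
lemma2 G r _ connected _ ss _ P (Ψ⇔⋃P , _ , _) respects u =
  mk⇔ (κ⊆⋃κ (connected u r)) λ (i , covered) → κ-mono (Pᵢ⊆Ψ i) covered
  where
  open Walks G using (κ-mono)
  open Rerouting G r (protectedSet G r ss) P (Equivalence.to (Ψ⇔⋃P _)) respects
  Pᵢ⊆Ψ : ∀ i → P i Sub.⊆ protectedSet G r ss
  Pᵢ⊆Ψ i v∈Pᵢ = Equivalence.from (Ψ⇔⋃P _) (i , v∈Pᵢ)
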